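{- Let $R$ be a finite group, identified with its right regular permutation representation, and let $G\leq\mathrm{Sym}(R)$ be a transitive group properly containing $R$. Let $G_1$ be the stabilizer of $1$ in $G$ and $K=\bigcap_{g\in G}R^g$ (a normal subgroup of $R$); $G_1$ permutes the set $R/K$ of cosets $Kx$. Let $\Delta\subseteq R/K$ be an orbit of $G_1$ on $R/K$ such that $\Delta$ is closed under inversion in the group $R/K$, and let $\widetilde\Delta\subseteq R$ be the union of the cosets in $\Delta$. Let $\mathcal{M}$ be the set of inverse-closed subsets $S\subseteq\widetilde\Delta$ that intersect $\widetilde\Delta$ evenly. Then $|\mathcal{M}|\leq 2^{\mathbf{c}(\widetilde\Delta)-\mathbf{c}(\Delta)+1}$, where $\mathbf{c}(\Delta)$ is computed in the group $R/K$.
   Context: $\mathcal{I}(X)$ is the set of elements of $X$ of order at most $2$ and $\mathbf{c}(X)=(|X|+|\mathcal{I}(X)|)/2$. A subset $S$ is inverse-closed if $S=S^{ -1}$. $S$ intersects $\widetilde\Delta=\Lambda_1\cup\dots\cup\Lambda_b$ (a union of $K$-cosets) evenly if $|S\cap\Lambda_1|=\dots=|S\cap\Lambda_b|$. -}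

module Defs where

open import Level using (0ℓ)
open import Data.Nat using (ℕ; _+_; _*_; _^_; _≤_; _/_)
open import Data.Fin using (Fin)
open import Data.Fin.Subset using (Subset; _∈_)
open import Data.List using (List; length)
open import Data.List.Relation.Unary.All using (All)
open import Data.List.Relation.Unary.Any using (Any)
open import Data.List.Relation.Unary.AllPairs using (AllPairs)
open import Data.Product using (Σ; ∃; _×_)
open import Function using (_∘_; id)
open import Relation.Nullary using (¬_)
open import Relation.Binary.PropositionalEquality using (_≡_; _≗_)
open import Algebra.Structures using (IsGroup)

record FinGroup (n : ℕ) : Set where
  infixl 7 _·_
  field
    _·_     : Fin n → Fin n → Fin n
    e       : Fin n
    inv     : Fin n → Fin n
    isGroup : IsGroup _≡_ _·_ e inv

-- Maps R → R (elements of Sym(R) are those that are bijective).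
Fun : ℕ → Set
Fun n = Fin n → Fin n

-- A group G ≤ Sym(R) given by a finite list enumerating its elements
-- (membership is up to pointwise equality of maps).
_∈G_ : ∀ {n} → Fun n → List (Fun n) → Set
g ∈G Gs = Any (λ h → g ≗ h) Gs

record IsPermGroup {n} (Gs : List (Fun n)) : Set where
  field
    id∈   : id ∈G Gs
    ∘∈    : ∀ g h → g ∈G Gs → h ∈G Gs → (g ∘ h) ∈G Gs
    inv∈  : ∀ g → g ∈G Gs → ∃ λ h → h ∈G Gs × (h ∘ g ≗ id) × (g ∘ h ≗ id)

-- "X has exactly k elements up to the equivalence _≈_": a duplicate-free
-- (w.r.t. _≈_) list of length k of elements of X representing every element.
Size : {A : Set} → (A → A → Set) → (A → Set) → ℕ → Set
Size {A} _≈_ P k = Σ (List A) λ L →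
  (length L ≡ k) × All P L × AllPairs (λ x y → ¬ (x ≈ y)) L × (∀ x → P x → Any (λ y → x ≈ y) L)

-- c(X) = (|X| + |I(X)|)/2 given |X| and |I(X)|
𝐜 : ℕ → ℕ → ℕ
𝐜 size invols = (size + invols) / 2

module _ {n : ℕ} (R : FinGroup n) (Gs : List (Fun n)) where
  open FinGroup R

  ρ : Fin n → Fun n
  ρ r x = x · r

  ContainsR : Set
  ContainsR = ∀ r → ρ r ∈G Gs

  IsTransitive : Set
  IsTransitive = ∀ x y → ∃ λ g → g ∈G Gs × g x ≡ y

  ProperlyContainsR : Set
  ProperlyContainsR = ∃ λ g → g ∈G Gs × ¬ (∃ λ r → g ≗ ρ r)

  Stab1 : Fun n → Set
  Stab1 g = g ∈G Gs × g e ≡ e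

  -- K = ⋂_{g ∈ G} R^g, as a subset of R:  ρ k ∈ g⁻¹ R g for all g ∈ G
  InK : Fin n → Set
  InK k = ∀ g → g ∈G Gs → ∃ λ r → (g ∘ ρ k) ≗ (ρ r ∘ g)

  SameCoset : Fin n → Fin n → Set
  SameCoset x y = InK (x · inv y)

  -- Δ̃ for the G₁-orbit Δ of the coset K x₀: union of the cosets K(x₀^g), g ∈ G₁
  Δ̃ : Fin n → Fin n → Set
  Δ̃ x₀ y = ∃ λ g → Stab1 g × SameCoset y (g x₀)

  IΔ̃ : Fin n → Fin n → Set
  IΔ̃ x₀ y = Δ̃ x₀ y × (y · y ≡ e)

  -- representatives of the cosets in Δ of order at most 2 in R/K
  IΔ : Fin n → Fin n → Set
  IΔ x₀ y = Δ̃ x₀ y × InK (y · y)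

  ΔInverseClosed : Fin n → Set
  ΔInverseClosed x₀ = ∀ y → Δ̃ x₀ y → Δ̃ x₀ (inv y)

  IntersectsEvenly : Fin n → Subset n → Set
  IntersectsEvenly x₀ S = ∀ x y m₁ m₂ → Δ̃ x₀ x → Δ̃ x₀ y →
    Size _≡_ (λ z → z ∈ S × SameCoset z x) m₁ →
    Size _≡_ (λ z → z ∈ S × SameCoset z y) m₂ → m₁ ≡ m₂

  InM : Fin n → Subset n → Set
  InM x₀ S = (∀ y → y ∈ S → Δ̃ x₀ y) × (∀ y → y ∈ S → inv y ∈ S) × IntersectsEvenly x₀ S

-- Call x ≃ y when the K-cosets of x and y are equal or mutually inverse. Pick representatives P
-- of the pairs {x, x⁻¹} in Δ̃ and y₀ ∷ Ys of the ≃-classes in Δ̃; counting gives |P| = c(Δ̃) and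
-- 1 + |Ys| = c(Δ). Map S ∈ 𝓜 and bits on Ys to the bits on P of S with the pairs {y, y⁻¹}
-- toggled where the bit of y is set. As S is inverse-closed, the image determines the toggled
-- set on all of Δ̃. Two preimages differing at y would agree on Ky₀, while one of them would have
-- strictly more elements in Ky, which evenness forbids; so the map is injective and
-- |𝓜| · 2^|Ys| ≤ 2^|P|.
module Submission where

open import Level using (0ℓ)
open import Algebra.Bundles using (Group; CommutativeRing)
open import Algebra.Structures using (IsGroup)
import Algebra.Properties.Group as GroupProperties
open import Data.Bool using (Bool; true; false; _xor_)
import Data.Bool.Properties as Bool
open import Data.Bool.Properties using (⇔→≡; not-¬)
open import Data.Empty using (⊥; ⊥-elim)
open import Data.Fin using (Fin; zero; suc; combine; remQuot; funToFin; finToFun; inject; fromℕ<)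
  renaming (_<_ to _<ᶠ_)
open import Data.Fin.Properties
  using ( _≟_; ≡-isDecEquivalence; any?; all?; ¬∀⟶∃¬-smallest; injective⇒≤; 2↔Bool
        ; toℕ-injective; toℕ-inject; toℕ-fromℕ<; combine-remQuot; funToFin-finToFin; finToFun-funToFin)
  renaming (_<?_ to _<ᶠ?_; <-cmp to <ᶠ-cmp)
open import Data.Fin.Subset using (Subset) renaming (_∈_ to _∈ₛ_)
open import Data.Fin.Subset.Properties using () renaming (_∈?_ to _∈ₛ?_)
open import Data.List using (List; []; _∷_; length; lookup; filter; allFin; map; _++_)
open import Data.List.Properties using (length-++; length-map)
open import Data.List.Membership.Propositional using (_∈_; find; lose)
open import Data.List.Membership.Propositional.Properties
  using (∈-lookup; ∈-filter⁺; ∈-filter⁻; ∈-map⁺; ∈-allFin)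
import Data.List.Membership.Setoid as MembershipSetoid
open import Data.List.Relation.Unary.All as All using (All; []; _∷_)
import Data.List.Relation.Unary.All.Properties as Allₚ
open import Data.List.Relation.Unary.Any as Any using (Any; here; there)
open import Data.List.Relation.Unary.Any.Properties using (lookup-index; ¬Any[])
import Data.List.Relation.Unary.Any.Properties as Anyₚ
open import Data.List.Relation.Unary.AllPairs as AllPairs using (AllPairs; []; _∷_)
import Data.List.Relation.Unary.AllPairs.Properties as AllPairsₚ
import Data.List.Relation.Unary.Unique.Setoid as UniqueSetoid
open import Data.List.Relation.Unary.Unique.Propositional.Properties using (allFin⁺)
open import Data.Nat as ℕ using (ℕ; _+_; _*_; _^_; _/_; _≤_; _<_)
open import Data.Nat.Properties
  using (+-suc; +-comm; +-assoc; +-identityʳ; *-comm; *-assoc; *-monoʳ-≤; ≤-antisym; <-irrefl; module ≤-Reasoning)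
open import Data.Nat.DivMod using (m*n/n≡m)
open import Data.Product using (∃; _×_; _,_; proj₁; uncurry; map₁; map₂)
open import Data.Sum using (_⊎_; inj₁; inj₂; [_,_])
import Data.Vec as Vec
open import Data.Vec.Properties using ([]=⇒lookup; lookup⇒[]=; tabulate∘lookup; tabulate-cong)
open import Function using (_∘_; id; Inverse)
open import Function.Bundles using (mk⇔)
open import Relation.Binary using (Setoid; Rel; IsEquivalence; IsDecEquivalence; tri<; tri≈; tri>)
open import Relation.Binary.PropositionalEquality
  using (_≡_; _≢_; refl; sym; trans; cong; cong₂; subst; _≗_; setoid; module ≡-Reasoning)
open import Relation.Nullary using (¬_; Dec; yes; no)
open import Relation.Nullary.Decidable
  using (map′; _⊎-dec_; _×-dec_; _→-dec_; ¬?; decidable-stable; does; dec-true; dec-false; does-⇔)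
open import Relation.Unary using (Pred; Decidable)
open import Defs

module _ {a ℓ} (S : Setoid a ℓ) where
  open Setoid S using (_≈_) renaming (sym to ≈-sym; trans to ≈-trans)
  open MembershipSetoid S using () renaming (_∈_ to _∈≈_)
  open UniqueSetoid S using (Unique)

  lookup-injective : ∀ {xs} → Unique xs → ∀ {i j} → lookup xs i ≈ lookup xs j → i ≡ j
  lookup-injective (_   ∷ _) {zero}  {zero}  _  = refl
  lookup-injective (x≉ ∷ _) {zero}  {suc j} eq = ⊥-elim (All.lookup x≉ (∈-lookup j) eq)
  lookup-injective (x≉ ∷ _) {suc i} {zero}  eq = ⊥-elim (All.lookup x≉ (∈-lookup i) (≈-sym eq))
  lookup-injective (_   ∷ u) {suc i} {suc j} eq = cong suc (lookup-injective u eq)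

  unique-≈⇒≡ : ∀ {xs x y} → Unique xs → x ∈ xs → y ∈ xs → x ≈ y → x ≡ y
  unique-≈⇒≡ (_   ∷ _) (here refl) (here refl) _   = refl
  unique-≈⇒≡ (x≉ ∷ _) (here refl) (there y∈)  x≈y = ⊥-elim (All.lookup x≉ y∈ x≈y)
  unique-≈⇒≡ (y≉ ∷ _) (there x∈)  (here refl) x≈y = ⊥-elim (All.lookup y≉ x∈ (≈-sym x≈y))
  unique-≈⇒≡ (_   ∷ u) (there x∈)  (there y∈)  x≈y = unique-≈⇒≡ u x∈ y∈ x≈y

  length-mono-⊆ : ∀ {xs ys} → Unique xs → All (_∈≈ ys) xs → length xs ≤ length ys
  length-mono-⊆ {xs} {ys} u xs⊆ys = injective⇒≤ index-injective
    where
    position : ∀ i → lookup xs i ∈≈ ys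
    position i = All.lookup xs⊆ys (∈-lookup i)

    index-injective : ∀ {i j} → Any.index (position i) ≡ Any.index (position j) → i ≡ j
    index-injective {i} {j} eq = lookup-injective u (≈-trans (lookup-index (position i))
      (≈-sym (subst (λ k → lookup xs j ≈ lookup ys k) (sym eq) (lookup-index (position j)))))

count : ∀ {n} {P : Pred (Fin n) 0ℓ} → Decidable P → ℕ
count {n} P? = length (filter P? (allFin n))

size-count : ∀ {n} {P : Pred (Fin n) 0ℓ} (P? : Decidable P) → Size _≡_ P (count P?)
size-count {n} P? =
  filter P? (allFin n) , refl , Allₚ.all-filter P? (allFin n) , AllPairsₚ.filter⁺ P? (allFin⁺ n) ,
  λ z Pz → ∈-filter⁺ P? (∈-allFin z) Pz

module _ {n} {P Q : Pred (Fin n) 0ℓ} (P? : Decidable P) (Q? : Decidable Q) (P⊆Q : ∀ {z} → P z → Q z) where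

  private
    P-all : All P (filter P? (allFin n))
    P-all = Allₚ.all-filter P? (allFin n)

    P⊆Q-lists : All (_∈ filter Q? (allFin n)) (filter P? (allFin n))
    P⊆Q-lists = All.map (λ {z} Pz → ∈-filter⁺ Q? (∈-allFin z) (P⊆Q Pz)) P-all

  count-mono : count P? ≤ count Q?
  count-mono = length-mono-⊆ (setoid (Fin n)) (AllPairsₚ.filter⁺ P? (allFin⁺ n)) P⊆Q-lists

  count-mono-< : ∀ {w} → Q w → ¬ P w → count P? < count Q?
  count-mono-< {w} Qw ¬Pw = length-mono-⊆ (setoid (Fin n))
    (All.map (λ { Pz refl → ¬Pw Pz }) P-all ∷ AllPairsₚ.filter⁺ P? (allFin⁺ n))
    (∈-filter⁺ Q? (∈-allFin w) Qw ∷ P⊆Q-lists)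

length-filter-split : ∀ {A : Set} {P : Pred A 0ℓ} (P? : Decidable P) xs →
  length (filter P? xs) + length (filter (¬? ∘ P?) xs) ≡ length xs
length-filter-split P? []       = refl
length-filter-split P? (x ∷ xs) with P? x
... | yes _ = cong ℕ.suc (length-filter-split P? xs)
... | no  _ = trans (+-suc _ _) (cong ℕ.suc (length-filter-split P? xs))

encode : ∀ {p} → (Fin p → Bool) → Fin (2 ^ p)
encode f = funToFin (Inverse.from 2↔Bool ∘ f)

bits : ∀ {p} → Fin (2 ^ p) → Fin p → Bool
bits t = Inverse.to 2↔Bool ∘ finToFun t

bits-encode : ∀ {p} (f : Fin p → Bool) → bits (encode f) ≗ f
bits-encode f x = trans (cong (Inverse.to 2↔Bool) (finToFun-funToFin (Inverse.from 2↔Bool ∘ f) x))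
  (Inverse.inverseˡ 2↔Bool refl)

funToFin-cong : ∀ {m k} {f g : Fin m → Fin k} → f ≗ g → funToFin f ≡ funToFin g
funToFin-cong {ℕ.zero}  _   = refl
funToFin-cong {ℕ.suc m} f≗g = cong₂ combine (f≗g zero) (funToFin-cong (f≗g ∘ suc))

encode-bits : ∀ {p} (t : Fin (2 ^ p)) → encode (bits {p} t) ≡ t
encode-bits {p} t = trans (funToFin-cong {p} (λ x → Inverse.inverseʳ 2↔Bool refl)) (funToFin-finToFin {p} {2} t)

bits-injective : ∀ {p} {s t : Fin (2 ^ p)} → bits {p} s ≗ bits t → s ≡ t
bits-injective {p} {s} {t} eq = begin
  s                     ≡⟨ encode-bits {p} s ⟨
  encode (bits {p} s)   ≡⟨ funToFin-cong {p} (cong (Inverse.from 2↔Bool) ∘ eq) ⟩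
  encode (bits {p} t)   ≡⟨ encode-bits {p} t ⟩
  t                 ∎
  where open ≡-Reasoning

injective⇒≤-2^ : ∀ {k p} (f : Fin k → Fin p → Bool) → (∀ {i j} → f i ≗ f j → i ≡ j) → k ≤ 2 ^ p
injective⇒≤-2^ f inj = injective⇒≤ λ {i} {j} eq → inj λ x → begin
  f i x                ≡⟨ bits-encode (f i) x ⟨
  bits (encode (f i)) x ≡⟨ cong (λ t → bits t x) eq ⟩
  bits (encode (f j)) x ≡⟨ bits-encode (f j) x ⟩
  f j x                ∎
  where open ≡-Reasoning

injective⇒*-2^-≤-2^ : ∀ {m u p} (F : Fin m → (Fin u → Bool) → Fin p → Bool) →
  (∀ {i j bs bs′} → F i bs ≗ F j bs′ → i ≡ j × bs ≗ bs′) → m * 2 ^ u ≤ 2 ^ p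
injective⇒*-2^-≤-2^ {m} {u} F inj =
  injective⇒≤-2^ (uncurry (λ i t → F i (bits {u} t)) ∘ split) λ {x} {y} eq →
  let i≡j , bits≗ = inj eq in begin
    x                        ≡⟨ combine-remQuot {m} (2 ^ u) x ⟨
    uncurry combine (split x) ≡⟨ cong₂ combine i≡j (bits-injective {u} bits≗) ⟩
    uncurry combine (split y) ≡⟨ combine-remQuot {m} (2 ^ u) y ⟩
    y                        ∎
  where
  open ≡-Reasoning
  split : Fin (m * 2 ^ u) → Fin m × Fin (2 ^ u)
  split = remQuot {m} (2 ^ u)

group : ∀ {n} → FinGroup n → Group 0ℓ 0ℓ
group {n} R = record { Carrier = Fin n ; _≈_ = _≡_ ; _∙_ = _·_ ; ε = e ; _⁻¹ = inv ; isGroup = isGroup }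
  where open FinGroup R

record IsNormalSubgroup {n} (R : FinGroup n) (N : Pred (Fin n) 0ℓ) : Set where
  open FinGroup R
  field
    e-closed    : N e
    ·-closed    : ∀ {x y} → N x → N y → N (x · y)
    inv-closed  : ∀ {x} → N x → N (inv x)
    conj-closed : ∀ {k} → N k → ∀ r → N (inv r · k · r)

module Cosets {n} {R : FinGroup n} {N : Pred (Fin n) 0ℓ} (N-normal : IsNormalSubgroup R N) where
  open FinGroup R
  open IsNormalSubgroup N-normal
  open IsGroup isGroup using (assoc; inverseʳ)
  open GroupProperties (group R) using (⁻¹-involutive; ⁻¹-anti-homo-∙; \\-leftDividesʳ; //-rightDividesˡ)
  open ≡-Reasoning

  infix 4 _~_
  _~_ : Rel (Fin n) 0ℓ
  x ~ y = N (x · inv y)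

  ~-isEquivalence : IsEquivalence _~_
  ~-isEquivalence = record { refl = ~-refl ; sym = ~-sym ; trans = ~-trans }
    where
    ~-refl : ∀ {x} → x ~ x
    ~-refl {x} = subst N (sym (inverseʳ x)) e-closed

    ~-sym : ∀ {x y} → x ~ y → y ~ x
    ~-sym {x} {y} = subst N (begin
      inv (x · inv y)       ≡⟨ ⁻¹-anti-homo-∙ x (inv y) ⟩
      inv (inv y) · inv x   ≡⟨ cong (_· inv x) (⁻¹-involutive y) ⟩
      y · inv x             ∎) ∘ inv-closed

    ~-trans : ∀ {x y z} → x ~ y → y ~ z → x ~ z
    ~-trans {x} {y} {z} p q = subst N (begin
      (x · inv y) · (y · inv z) ≡⟨ assoc x (inv y) (y · inv z) ⟩
      x · (inv y · (y · inv z)) ≡⟨ cong (x ·_) (\\-leftDividesʳ y (inv z)) ⟩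
      x · inv z                 ∎) (·-closed p q)

  ~-inv : ∀ {x y} → x ~ y → inv x ~ inv y
  ~-inv {x} {y} p = subst N (begin
      inv x · (y · inv x) · x   ≡⟨ assoc (inv x) (y · inv x) x ⟩
      inv x · ((y · inv x) · x) ≡⟨ cong (inv x ·_) (//-rightDividesˡ x y) ⟩
      inv x · y                 ≡⟨ cong (inv x ·_) (⁻¹-involutive y) ⟨
      inv x · inv (inv y)       ∎) (conj-closed (IsEquivalence.sym ~-isEquivalence p) x)

module _ {n} (R : FinGroup n) (Gs : List (Fun n)) where
  open FinGroup R
  open IsGroup isGroup using (assoc; identityʳ)
  open GroupProperties (group R) using (//-rightDividesˡ; //-rightDividesʳ)
  open ≡-Reasoning

  InK-isNormalSubgroup : IsPermGroup Gs → ContainsR R Gs → IsNormalSubgroup R (InK R Gs)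
  InK-isNormalSubgroup pg cR = record
    { e-closed    = λ g _ → e , λ x → trans (cong g (identityʳ x)) (sym (identityʳ (g x)))
    ; ·-closed    = ·-closed
    ; inv-closed  = inv-closed
    ; conj-closed = conj-closed
    }
    where
    open IsPermGroup pg using (∘∈)

    ·-closed : ∀ {a b} → InK R Gs a → InK R Gs b → InK R Gs (a · b)
    ·-closed {a} {b} Ka Kb g g∈ with r , hr ← Ka g g∈ | s , hs ← Kb g g∈ = r · s , λ x → begin
      g (x · (a · b)) ≡⟨ cong g (assoc x a b) ⟨
      g ((x · a) · b) ≡⟨ hs (x · a) ⟩
      g (x · a) · s   ≡⟨ cong (_· s) (hr x) ⟩
      (g x · r) · s   ≡⟨ assoc (g x) r s ⟩
      g x · (r · s)   ∎

    inv-closed : ∀ {a} → InK R Gs a → InK R Gs (inv a)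
    inv-closed {a} Ka g g∈ with r , hr ← Ka g g∈ = inv r , λ x → begin
      g (x · inv a)                ≡⟨ //-rightDividesʳ r (g (x · inv a)) ⟨
      (g (x · inv a) · r) · inv r  ≡⟨ cong (_· inv r) (hr (x · inv a)) ⟨
      g ((x · inv a) · a) · inv r  ≡⟨ cong (λ t → g t · inv r) (//-rightDividesˡ a x) ⟩
      g x · inv r                  ∎

    conj-closed : ∀ {k} → InK R Gs k → ∀ r → InK R Gs (inv r · k · r)
    conj-closed {k} Kk r g g∈ with s , hs ← Kk (g ∘ ρ R Gs r) (∘∈ g (ρ R Gs r) g∈ (cR r)) =
      s , λ x → begin
      g (x · (inv r · k · r))  ≡⟨ cong g (trans (cong (_· r) (assoc x (inv r) k)) (assoc x (inv r · k) r)) ⟨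
      g ((x · inv r) · k · r)  ≡⟨ hs (x · inv r) ⟩
      g ((x · inv r) · r) · s  ≡⟨ cong (λ t → g t · s) (//-rightDividesˡ r x) ⟩
      g x · s                  ∎

  InK? : Decidable (InK R Gs)
  InK? k = map′
    (λ all g g∈ → All.lookupWith (λ (r , hr) g≗h → r , λ x →
       trans (g≗h (x · k)) (trans (hr x) (cong (_· r) (sym (g≗h x))))) all g∈)
    (λ Kk → All.tabulate λ h∈ → Kk _ (Any.map (λ { refl _ → refl }) h∈))
    (All.all? (λ h → any? λ r → all? λ x → h (x · k) ≟ h x · r) Gs)

open GroupProperties (CommutativeRing.+-group Bool.xor-∧-commutativeRing) using ()
  renaming (∙-cancelˡ to xor-cancelˡ; ∙-cancelʳ to xor-cancelʳ)

module InversePairs {n} (ι : Fin n → Fin n) (ι-involutive : ∀ x → ι (ι x) ≡ x)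
  {_~_ : Rel (Fin n) 0ℓ} (~-isDecEquivalence : IsDecEquivalence _~_)
  (~-ι : ∀ {x y} → x ~ y → ι x ~ ι y)
  {D : Pred (Fin n) 0ℓ} (D-ι : ∀ {x} → D x → D (ι x)) (D-~ : ∀ {x y} → D y → x ~ y → D x) where

  open IsDecEquivalence ~-isDecEquivalence using () renaming
    (isEquivalence to ~-isEquivalence; refl to ~-refl; sym to ~-sym; trans to ~-trans; _≟_ to _~?_)

  ~-setoid : Setoid 0ℓ 0ℓ
  ~-setoid = record { Carrier = Fin n ; _≈_ = _~_ ; isEquivalence = ~-isEquivalence }

  ~-ι-flip : ∀ {x y} → x ~ ι y → ι x ~ y
  ~-ι-flip {x} {y} p = subst (ι x ~_) (ι-involutive y) (~-ι p)

  ~-ι⁻¹ : ∀ {x y} → ι x ~ ι y → x ~ y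
  ~-ι⁻¹ {x} {y} p = subst (_~ y) (ι-involutive x) (~-ι-flip p)

  infix 4 _≃_
  _≃_ : Rel (Fin n) 0ℓ
  x ≃ y = x ~ y ⊎ x ~ ι y

  _≃?_ : ∀ x y → Dec (x ≃ y)
  x ≃? y = x ~? y ⊎-dec x ~? ι y

  ≃-refl : ∀ {x} → x ≃ x
  ≃-refl = inj₁ ~-refl

  ≃-sym : ∀ {x y} → x ≃ y → y ≃ x
  ≃-sym (inj₁ p) = inj₁ (~-sym p)
  ≃-sym (inj₂ p) = inj₂ (~-sym (~-ι-flip p))

  ≃-trans : ∀ {x y z} → x ≃ y → y ≃ z → x ≃ z
  ≃-trans (inj₁ p) (inj₁ q) = inj₁ (~-trans p q)
  ≃-trans (inj₁ p) (inj₂ q) = inj₂ (~-trans p q)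
  ≃-trans (inj₂ p) (inj₁ q) = inj₂ (~-trans p (~-ι q))
  ≃-trans (inj₂ p) (inj₂ q) = inj₁ (~-trans p (~-ι-flip q))

  ≃-setoid : Setoid 0ℓ 0ℓ
  ≃-setoid = record
    { Carrier = Fin n ; _≈_ = _≃_ ; isEquivalence = record { refl = ≃-refl ; sym = ≃-sym ; trans = ≃-trans } }

  ≃-ιˡ : ∀ {x y} → x ≃ y → ι x ≃ y
  ≃-ιˡ (inj₁ p) = inj₂ (~-ι p)
  ≃-ιˡ (inj₂ p) = inj₁ (~-ι-flip p)

  D-≃ : ∀ {x y} → D y → x ≃ y → D x
  D-≃ Dy (inj₁ p) = D-~ Dy p
  D-≃ Dy (inj₂ p) = D-~ (D-ι Dy) p

  SelfInverse : Pred (Fin n) 0ℓ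
  SelfInverse y = y ~ ι y

  selfInverse-≃ : ∀ {x y} → x ≃ y → SelfInverse x → SelfInverse y
  selfInverse-≃ (inj₁ p) sx = ~-trans (~-sym p) (~-trans sx (~-ι p))
  selfInverse-≃ (inj₂ p) sx = ~-trans (~-sym (~-ι-flip p)) (~-trans (~-ι-flip sx) p)

  ≃⇒~ : ∀ {x y} → x ≃ y → SelfInverse y → x ~ y
  ≃⇒~ (inj₁ p) _  = p
  ≃⇒~ (inj₂ p) sy = ~-trans p (~-sym sy)

  record Transversal (Y : List (Fin n)) : Set where
    field
      unique : UniqueSetoid.Unique ≃-setoid Y
      ⊆D     : All D Y
      covers : ∀ {z} → D z → Any (z ≃_) Y

  Least : Pred (Fin n) 0ℓ
  Least y = ∀ z → z <ᶠ y → ¬ z ≃ y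

  least? : Decidable Least
  least? y = all? λ z → z <ᶠ? y →-dec ¬? (z ≃? y)

  least-unique : ∀ {x y} → Least x → Least y → x ≃ y → x ≡ y
  least-unique {x} {y} lx ly x≃y with <ᶠ-cmp x y
  ... | tri< x<y _ _ = ⊥-elim (ly x x<y x≃y)
  ... | tri≈ _ x≡y _ = x≡y
  ... | tri> _ _ y<x = ⊥-elim (lx y y<x (≃-sym x≃y))

  ≃-least : ∀ z → ∃ λ y → Least y × z ≃ y
  ≃-least z
    with y , ¬y≄z , below ← ¬∀⟶∃¬-smallest n (λ w → ¬ w ≃ z) (λ w → ¬? (w ≃? z)) (λ none → none z ≃-refl)
    = y , least , ≃-sym y≃z
    where
    y≃z : y ≃ z
    y≃z = decidable-stable (y ≃? z) ¬y≄z

    least : Least y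
    least w w<y w≃y = below (fromℕ< w<y) (subst (_≃ z) (sym inject-fromℕ<) (≃-trans w≃y y≃z))
      where
      inject-fromℕ< : inject (fromℕ< w<y) ≡ w
      inject-fromℕ< = toℕ-injective (trans (toℕ-inject (fromℕ< w<y)) (toℕ-fromℕ< w<y))

  transversal : ∀ {a} → Size _≡_ D a → ∃ Transversal
  transversal (L , _ , L⊆D , L-unique , L-covers) = filter least? L , record
    { unique = leasts-unique (AllPairsₚ.filter⁺ least? L-unique) (Allₚ.all-filter least? L)
    ; ⊆D     = Allₚ.filter⁺ least? L⊆D
    ; covers = λ {z} Dz → let y , least-y , z≃y = ≃-least z in
        Any.map (λ { refl → z≃y }) (∈-filter⁺ least? (L-covers y (D-≃ Dz (≃-sym z≃y))) least-y)
    }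
    where
    leasts-unique : ∀ {xs} → AllPairs _≢_ xs → All Least xs → AllPairs (λ x y → ¬ x ≃ y) xs
    leasts-unique []           []          = []
    leasts-unique (x∉ ∷ xs-u) (lx ∷ lxs) =
      All.zipWith (λ (x≢y , ly) x≃y → x≢y (least-unique lx ly x≃y)) (x∉ , lxs) ∷ leasts-unique xs-u lxs

  module _ {Y} (Y-tr : Transversal Y) where
    open Transversal Y-tr

    selfInverse? : Decidable SelfInverse
    selfInverse? y = y ~? ι y

    selfInverses others classReps : List (Fin n)
    selfInverses = filter selfInverse? Y
    others       = filter (¬? ∘ selfInverse?) Y
    classReps      = Y ++ map ι others

    Y-~-unique : AllPairs (λ x y → ¬ x ~ y) Y
    Y-~-unique = AllPairs.map (λ x≄y x~y → x≄y (inj₁ x~y)) unique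

    classReps-unique : AllPairs (λ x y → ¬ x ~ y) classReps
    classReps-unique = AllPairsₚ.++⁺ Y-~-unique
      (AllPairsₚ.map⁺ (AllPairs.map (λ x≁y → x≁y ∘ ~-ι⁻¹) (AllPairsₚ.filter⁺ _ Y-~-unique)))
      (All.tabulate λ x∈Y → Allₚ.map⁺ (All.tabulate λ y∈ x~ιy →
        let y∈Y , ¬sy = ∈-filter⁻ (¬? ∘ selfInverse?) {xs = Y} y∈ in
        ¬sy (subst (_~ ι _) (unique-≈⇒≡ ≃-setoid unique x∈Y y∈Y (inj₂ x~ιy)) x~ιy)))

    classReps-⊆D : All D classReps
    classReps-⊆D = Allₚ.++⁺ ⊆D (Allₚ.map⁺ (All.map D-ι (Allₚ.filter⁺ _ ⊆D)))

    classReps-covers : ∀ {z} → D z → Any (z ~_) classReps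
    classReps-covers Dz with y , y∈Y , z≃y ← find (covers Dz) | selfInverse? y | z≃y
    ... | yes sy | _        = Anyₚ.++⁺ˡ (lose y∈Y (≃⇒~ z≃y sy))
    ... | no  _  | inj₁ z~y = Anyₚ.++⁺ˡ (lose y∈Y z~y)
    ... | no ¬sy | inj₂ z~ιy = Anyₚ.++⁺ʳ Y (lose (∈-map⁺ ι (∈-filter⁺ _ y∈Y ¬sy)) z~ιy)

    selfInverses-covers : ∀ {z} → D z → SelfInverse z → Any (z ~_) selfInverses
    selfInverses-covers Dz sz with y , y∈Y , z≃y ← find (covers Dz) =
      lose (∈-filter⁺ _ y∈Y (selfInverse-≃ z≃y sz)) (≃⇒~ z≃y (selfInverse-≃ z≃y sz))

    -- Each ≃-class in D is a single self-inverse ~-class or two mutually inverse ones.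
    transversal-count : ∀ {Q : Pred (Fin n) 0ℓ} {c d} → Size _~_ D c → Size _~_ Q d →
      (∀ {y} → Q y → D y × SelfInverse y) → (∀ {y} → D y → SelfInverse y → Q y) →
      length Y + length Y ≡ c + d
    transversal-count (LC , refl , LC⊆D , LC-unique , LC-covers)
                      (LQ , refl , LQ⊆Q , LQ-unique , LQ-covers) Q⇒ ⇒Q =
      begin
        length Y + length Y                              ≡⟨ cong (length Y +_) (length-filter-split selfInverse? Y) ⟨
        length Y + (length selfInverses + length others) ≡⟨ cong (length Y +_) (+-comm (length selfInverses) _) ⟩
        length Y + (length others + length selfInverses) ≡⟨ +-assoc (length Y) _ _ ⟨
        length Y + length others + length selfInverses   ≡⟨ cong (_+ length selfInverses) #classReps ⟨
        length classReps + length selfInverses           ≡⟨ cong₂ _+_ classReps≡LC selfInverses≡LQ ⟩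
        length LC + length LQ                            ∎
      where
      open ≡-Reasoning
      #classReps : length classReps ≡ length Y + length others
      #classReps = trans (length-++ Y) (cong (length Y +_) (length-map ι others))

      classReps≡LC : length classReps ≡ length LC
      classReps≡LC = ≤-antisym
        (length-mono-⊆ ~-setoid classReps-unique (All.map (LC-covers _) classReps-⊆D))
        (length-mono-⊆ ~-setoid LC-unique (All.map classReps-covers LC⊆D))

      selfInverses≡LQ : length selfInverses ≡ length LQ
      selfInverses≡LQ = ≤-antisym
        (length-mono-⊆ ~-setoid (AllPairsₚ.filter⁺ _ Y-~-unique) (All.tabulate λ y∈ →
          let y∈Y , sy = ∈-filter⁻ _ y∈ in LQ-covers _ (⇒Q (All.lookup ⊆D y∈Y) sy)))
        (length-mono-⊆ ~-setoid LQ-unique (All.map (uncurry selfInverses-covers ∘ Q⇒) LQ⊆Q))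

  -- For D = Δ̃ and ~ = SameCoset this is InM, the membership predicate of 𝓜.
  Balanced : Subset n → Set
  Balanced S = (∀ y → y ∈ₛ S → D y) × (∀ y → y ∈ₛ S → ι y ∈ₛ S) ×
    (∀ x y m₁ m₂ → D x → D y →
      Size _≡_ (λ z → z ∈ₛ S × z ~ x) m₁ → Size _≡_ (λ z → z ∈ₛ S × z ~ y) m₂ → m₁ ≡ m₂)

  _∩[_]? : ∀ S w → Decidable (λ z → z ∈ₛ S × z ~ w)
  (S ∩[ w ]?) z = z ∈ₛ? S ×-dec z ~? w

  #_∩[_] : Subset n → Fin n → ℕ
  # S ∩[ w ] = count (S ∩[ w ]?)

  balanced-# : ∀ {S x y} → Balanced S → D x → D y → # S ∩[ x ] ≡ # S ∩[ y ]
  balanced-# (_ , _ , even) Dx Dy = even _ _ _ _ Dx Dy (size-count _) (size-count _)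

  lookup-ι : ∀ {S} → Balanced S → ∀ z → Vec.lookup S (ι z) ≡ Vec.lookup S z
  lookup-ι {S} (_ , ι-closed , _) z = ⇔→≡ {z = true} (mk⇔
    (λ e → []=⇒lookup (subst (_∈ₛ S) (ι-involutive z) (ι-closed (ι z) (lookup⇒[]= (ι z) S e))))
    (λ e → []=⇒lookup (ι-closed z (lookup⇒[]= z S e))))

  module Flip {y₀ Ys} (Y-tr : Transversal (y₀ ∷ Ys)) {P : List (Fin n)}
    (P-covers : ∀ {z} → D z → Any (λ p → z ≡ p ⊎ z ≡ ι p) P) where
    open Transversal Y-tr

    u : ℕ
    u = length Ys

    y : Fin u → Fin n
    y = lookup Ys

    y-injective : ∀ {i j} → y i ≃ y j → i ≡ j
    y-injective = lookup-injective ≃-setoid (AllPairs.tail unique)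

    y≄y₀ : ∀ k → ¬ y k ≃ y₀
    y≄y₀ k = All.lookup (AllPairs.head unique) (∈-lookup k) ∘ ≃-sym

    Dy₀ : D y₀
    Dy₀ = All.head ⊆D

    Dy : ∀ j → D (y j)
    Dy j = All.lookup (All.tail ⊆D) (∈-lookup j)

    Hits : Fin n → Fin n → Set
    Hits z w = z ≡ w ⊎ ι z ≡ w

    hits⇒≃ : ∀ {z w} → Hits z w → w ≃ z
    hits⇒≃ (inj₁ refl) = ≃-refl
    hits⇒≃ (inj₂ refl) = ≃-ιˡ ≃-refl

    hits-ι : ∀ {z w} → Hits z w → Hits (ι z) w
    hits-ι {z} (inj₁ z≡w)  = inj₂ (trans (ι-involutive z) z≡w)
    hits-ι     (inj₂ ιz≡w) = inj₁ ιz≡w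

    Flipped : (Fin u → Bool) → Pred (Fin n) 0ℓ
    Flipped bs z = ∃ λ k → bs k ≡ true × Hits z (y k)

    flipped? : ∀ bs → Decidable (Flipped bs)
    flipped? bs z = any? λ k → (bs k Bool.≟ true) ×-dec (z ≟ y k ⊎-dec ι z ≟ y k)

    flip : (Fin u → Bool) → Fin n → Bool
    flip bs = does ∘ flipped? bs

    flip-ι : ∀ bs z → flip bs (ι z) ≡ flip bs z
    flip-ι bs z =
      does-⇔ (mk⇔ (map₂ (map₂ ιι-hits)) (map₂ (map₂ hits-ι))) (flipped? bs (ι z)) (flipped? bs z)
      where
      ιι-hits : ∀ {w} → Hits (ι z) w → Hits z w
      ιι-hits = subst (λ t → Hits t _) (ι-involutive z) ∘ hits-ι

    flip-cong : ∀ {bs bs′} → bs ≗ bs′ → ∀ z → flip bs z ≡ flip bs′ z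
    flip-cong {bs} {bs′} bs≗bs′ z = does-⇔ (mk⇔
      (map₂ λ {k} → map₁ (trans (sym (bs≗bs′ k))))
      (map₂ λ {k} → map₁ (trans (bs≗bs′ k)))) (flipped? bs z) (flipped? bs′ z)

    flip-at : ∀ bs j → flip bs (y j) ≡ bs j
    flip-at bs j with bs j in eq
    ... | true  = dec-true (flipped? bs (y j)) (j , eq , inj₁ refl)
    ... | false = dec-false (flipped? bs (y j)) λ (k , bk , hit) →
      not-¬ refl (trans (sym bk) (trans (cong bs (y-injective (hits⇒≃ hit))) eq))

    unflipped-near-y₀ : ∀ bs {z} → z ~ y₀ → flip bs z ≡ false
    unflipped-near-y₀ bs {z} z~y₀ = dec-false (flipped? bs z) λ (k , _ , hit) →
      y≄y₀ k (≃-trans (hits⇒≃ hit) (inj₁ z~y₀))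

    unflipped-near : ∀ bs {z} j → z ~ y j → ¬ Hits z (y j) → flip bs z ≡ false
    unflipped-near bs {z} j z~yj miss = dec-false (flipped? bs z) λ (k , _ , hit) →
      miss (subst (Hits z ∘ y) (y-injective (≃-trans (hits⇒≃ hit) (inj₁ z~yj))) hit)

    mark : Subset n → (Fin u → Bool) → Fin n → Bool
    mark S bs z = Vec.lookup S z xor flip bs z

    mark-ι : ∀ {S} → Balanced S → ∀ bs z → mark S bs (ι z) ≡ mark S bs z
    mark-ι bal bs z = cong₂ _xor_ (lookup-ι bal z) (flip-ι bs z)

    code : Subset n → (Fin u → Bool) → Fin (length P) → Bool
    code S bs = mark S bs ∘ lookup P

    Agree : Subset n → (Fin u → Bool) → Subset n → (Fin u → Bool) → Set
    Agree S bs S′ bs′ = ∀ {z} → D z → mark S bs z ≡ mark S′ bs′ z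

    code≗⇒mark≡ : ∀ {S bs S′ bs′} → code S bs ≗ code S′ bs′ →
      ∀ {p} → p ∈ P → mark S bs p ≡ mark S′ bs′ p
    code≗⇒mark≡ {S} {bs} {S′} {bs′} eq p∈P =
      subst (λ q → mark S bs q ≡ mark S′ bs′ q) (sym (lookup-index p∈P)) (eq (Any.index p∈P))

    agree : ∀ {S bs S′ bs′} → Balanced S → Balanced S′ → code S bs ≗ code S′ bs′ → Agree S bs S′ bs′
    agree {S} {bs} {S′} {bs′} bal bal′ eq Dz with p , p∈P , z≡p⊎z≡ιp ← find (P-covers Dz) =
      [ (λ { refl → at-p })
      , (λ { refl → trans (mark-ι bal bs p) (trans at-p (sym (mark-ι bal′ bs′ p))) })
      ] z≡p⊎z≡ιp
      where
      at-p : mark S bs p ≡ mark S′ bs′ p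
      at-p = code≗⇒mark≡ {S} {bs} {S′} {bs′} eq p∈P

    agree-unflipped : ∀ {S bs S′ bs′ z} → Agree S bs S′ bs′ → D z →
      flip bs z ≡ false → flip bs′ z ≡ false → Vec.lookup S z ≡ Vec.lookup S′ z
    agree-unflipped {S} {bs} {S′} {bs′} {z} agr Dz f f′ = xor-cancelʳ false _ _ (begin
      Vec.lookup S z xor false      ≡⟨ cong (Vec.lookup S z xor_) f ⟨
      mark S bs z                   ≡⟨ agr Dz ⟩
      mark S′ bs′ z                 ≡⟨ cong (Vec.lookup S′ z xor_) f′ ⟩
      Vec.lookup S′ z xor false     ∎)
      where open ≡-Reasoning

    ∈-transfer : ∀ {S S′ : Subset n} {z} → Vec.lookup S z ≡ Vec.lookup S′ z → z ∈ₛ S → z ∈ₛ S′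
    ∈-transfer {S} {S′} {z} eq z∈S = lookup⇒[]= z S′ (trans (sym eq) ([]=⇒lookup z∈S))

    -- Toggling at y j but not at y₀ would make the counts of a balanced set on their cosets differ.
    no-gain : ∀ {S bs S′ bs′} → Balanced S → Balanced S′ → Agree S bs S′ bs′ →
      ∀ j → y j ∈ₛ S → ¬ y j ∈ₛ S′ → ⊥
    no-gain {S} {bs} {S′} {bs′} bal@(S⊆D , _ , _) bal′@(S′⊆D , ι-closed′ , _) agr j yj∈S yj∉S′ =
      <-irrefl refl (begin-strict
        # S ∩[ y j ]   ≡⟨ balanced-# bal (Dy j) Dy₀ ⟩
        # S ∩[ y₀ ]    ≤⟨ count-mono (S ∩[ y₀ ]?) (S′ ∩[ y₀ ]?) near-y₀ ⟩
        # S′ ∩[ y₀ ]   ≡⟨ balanced-# bal′ Dy₀ (Dy j) ⟩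
        # S′ ∩[ y j ]  <⟨ count-mono-< (S′ ∩[ y j ]?) (S ∩[ y j ]?) near-yj (yj∈S , ~-refl) (yj∉S′ ∘ proj₁) ⟩
        # S ∩[ y j ]   ∎)
      where
      open ≤-Reasoning

      same-unflipped : ∀ {z} → D z → flip bs z ≡ false → flip bs′ z ≡ false → Vec.lookup S z ≡ Vec.lookup S′ z
      same-unflipped = agree-unflipped {S} {bs} {S′} {bs′} agr

      near-y₀ : ∀ {z} → z ∈ₛ S × z ~ y₀ → z ∈ₛ S′ × z ~ y₀
      near-y₀ {z} (z∈S , z~y₀) =
        ∈-transfer (same-unflipped (S⊆D z z∈S) (unflipped-near-y₀ bs z~y₀) (unflipped-near-y₀ bs′ z~y₀)) z∈S , z~y₀

      near-yj : ∀ {z} → z ∈ₛ S′ × z ~ y j → z ∈ₛ S × z ~ y j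
      near-yj {z} (z∈S′ , z~yj) with z ≟ y j | ι z ≟ y j
      ... | yes refl  | _         = ⊥-elim (yj∉S′ z∈S′)
      ... | _         | yes ιz≡yj = ⊥-elim (yj∉S′ (subst (_∈ₛ S′) ιz≡yj (ι-closed′ z z∈S′)))
      ... | no z≢yj   | no ιz≢yj  = ∈-transfer (sym (same-unflipped (S′⊆D z z∈S′)
          (unflipped-near bs j z~yj miss) (unflipped-near bs′ j z~yj miss))) z∈S′ , z~yj
        where
        miss : ¬ Hits z (y j)
        miss = [ z≢yj , ιz≢yj ]

    ∉-lookup-false : ∀ {S : Subset n} {z} → Vec.lookup S z ≡ false → ¬ z ∈ₛ S
    ∉-lookup-false e z∈S = not-¬ refl (trans (sym ([]=⇒lookup z∈S)) e)

    representatives-agree : ∀ {S bs S′ bs′} → Balanced S → Balanced S′ → Agree S bs S′ bs′ →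
      ∀ j → Vec.lookup S (y j) ≡ Vec.lookup S′ (y j)
    representatives-agree {S} {bs} {S′} {bs′} bal bal′ agr j
      with Vec.lookup S (y j) in e | Vec.lookup S′ (y j) in e′
    ... | true  | true  = refl
    ... | false | false = refl
    ... | true  | false = ⊥-elim (no-gain bal bal′ agr j (lookup⇒[]= _ S e) (∉-lookup-false e′))
    ... | false | true  = ⊥-elim (no-gain bal′ bal (sym ∘ agr) j (lookup⇒[]= _ S′ e′) (∉-lookup-false e))

    code-injective : ∀ {S bs S′ bs′} → Balanced S → Balanced S′ →
      code S bs ≗ code S′ bs′ → S ≡ S′ × bs ≗ bs′
    code-injective {S} {bs} {S′} {bs′} bal@(S⊆D , _ , _) bal′@(S′⊆D , _ , _) eq = S≡S′ , bs≗bs′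
      where
      open ≡-Reasoning
      agr = agree bal bal′ eq

      bs≗bs′ : bs ≗ bs′
      bs≗bs′ j = begin
        bs j            ≡⟨ flip-at bs j ⟨
        flip bs (y j)   ≡⟨ xor-cancelˡ (Vec.lookup S (y j)) _ _ (trans (agr (Dy j))
                             (cong (_xor flip bs′ (y j)) (sym (representatives-agree bal bal′ agr j)))) ⟩
        flip bs′ (y j)  ≡⟨ flip-at bs′ j ⟩
        bs′ j           ∎

      agree-on-D : ∀ {z} → D z → Vec.lookup S z ≡ Vec.lookup S′ z
      agree-on-D {z} Dz = xor-cancelʳ (flip bs′ z) _ _
        (trans (cong (Vec.lookup S z xor_) (sym (flip-cong bs≗bs′ z))) (agr Dz))

      S≡S′ : S ≡ S′
      S≡S′ = begin
        S                          ≡⟨ tabulate∘lookup S ⟨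
        Vec.tabulate (Vec.lookup S)  ≡⟨ tabulate-cong (λ z → ⇔→≡ {z = true} (mk⇔
                                        (λ e → trans (sym (agree-on-D (S⊆D z (lookup⇒[]= z S e)))) e)
                                        (λ e → trans (agree-on-D (S′⊆D z (lookup⇒[]= z S′ e))) e))) ⟩
        Vec.tabulate (Vec.lookup S′) ≡⟨ tabulate∘lookup S′ ⟩
        S′                         ∎

    bound : ∀ {LM : List (Subset n)} → AllPairs _≢_ LM → All Balanced LM → length LM * 2 ^ u ≤ 2 ^ length P
    bound {LM} LM-unique LM-balanced = injective⇒*-2^-≤-2^ (code ∘ lookup LM) λ {i} {j} eq →
      let S≡S′ , bs≗bs′ = code-injective (balanced i) (balanced j) eq in
      lookup-injective (setoid (Subset n)) LM-unique S≡S′ , bs≗bs′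
      where
      balanced : ∀ i → Balanced (lookup LM i)
      balanced i = All.lookup LM-balanced (∈-lookup i)

  flip-bound : ∀ {Y P z} {LM : List (Subset n)} → Transversal Y →
    (∀ {z} → D z → Any (λ p → z ≡ p ⊎ z ≡ ι p) P) → D z →
    AllPairs _≢_ LM → All Balanced LM → length LM * 2 ^ length Y ≤ 2 ^ ℕ.suc (length P)
  flip-bound {[]} Y-tr _ Dz _ _ = ⊥-elim (¬Any[] (Transversal.covers Y-tr Dz))
  flip-bound {_ ∷ Ys} {P} {LM = LM} Y-tr P-covers _ LM-unique LM-balanced = begin
    length LM * (2 * 2 ^ length Ys)  ≡⟨ *-assoc (length LM) 2 _ ⟨
    length LM * 2 * 2 ^ length Ys    ≡⟨ cong (_* 2 ^ length Ys) (*-comm (length LM) 2) ⟩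
    2 * length LM * 2 ^ length Ys    ≡⟨ *-assoc 2 (length LM) _ ⟩
    2 * (length LM * 2 ^ length Ys)  ≤⟨ *-monoʳ-≤ 2 (Flip.bound Y-tr P-covers LM-unique LM-balanced) ⟩
    2 * 2 ^ length P                 ∎
    where open ≤-Reasoning

𝐜-double : ∀ {c d k} → k + k ≡ c + d → 𝐜 c d ≡ k
𝐜-double {c} {d} {k} eq = begin
  (c + d) / 2  ≡⟨ cong (_/ 2) eq ⟨
  (k + k) / 2  ≡⟨ cong (_/ 2) (trans (cong (k +_) (sym (+-identityʳ k))) (*-comm 2 k)) ⟩
  k * 2 / 2    ≡⟨ m*n/n≡m k 2 ⟩
  k            ∎
  where open ≡-Reasoning

module PairsInΔ̃ {n} (R : FinGroup n) (Gs : List (Fun n)) (pg : IsPermGroup Gs) (cR : ContainsR R Gs)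
  (x₀ : Fin n) (Δ-inverse-closed : ΔInverseClosed R Gs x₀) where
  open FinGroup R
  open IsGroup isGroup using (inverseʳ)
  open GroupProperties (group R) using (⁻¹-involutive; inverseˡ-unique)
  open Cosets (InK-isNormalSubgroup R Gs pg cR)

  Δ̃-resp : ∀ {x y} → Δ̃ R Gs x₀ y → x ~ y → Δ̃ R Gs x₀ x
  Δ̃-resp (g , g∈G₁ , y~gx₀) x~y = g , g∈G₁ , IsEquivalence.trans ~-isEquivalence x~y y~gx₀

  x₀∈Δ̃ : Δ̃ R Gs x₀ x₀
  x₀∈Δ̃ = id , (IsPermGroup.id∈ pg , refl) , IsEquivalence.refl ~-isEquivalence

  ~-isDecEquivalence : IsDecEquivalence _~_
  ~-isDecEquivalence = record { isEquivalence = ~-isEquivalence ; _≟_ = λ x y → InK? R Gs (x · inv y) }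

  Δ̃-≡-resp : ∀ {x y} → Δ̃ R Gs x₀ y → x ≡ y → Δ̃ R Gs x₀ x
  Δ̃-≡-resp Dy refl = Dy

  module ElementPairs =
    InversePairs inv ⁻¹-involutive ≡-isDecEquivalence (cong inv) (Δ-inverse-closed _) Δ̃-≡-resp
  module CosetPairs =
    InversePairs inv ⁻¹-involutive ~-isDecEquivalence ~-inv (Δ-inverse-closed _) Δ̃-resp

  element-transversal : ∀ {a b} → Size _≡_ (Δ̃ R Gs x₀) a → Size _≡_ (IΔ̃ R Gs x₀) b →
    ∃ λ P → ElementPairs.Transversal P × length P + length P ≡ a + b
  element-transversal sΔ sI with P , P-tr ← ElementPairs.transversal sΔ = P , P-tr ,
    ElementPairs.transversal-count P-tr sΔ sI
      (map₂ (inverseˡ-unique _ _))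
      (λ {y} Dy y≡y⁻¹ → Dy , trans (cong (y ·_) y≡y⁻¹) (inverseʳ y))

  coset-transversal : ∀ {a c d} → Size _≡_ (Δ̃ R Gs x₀) a → Size (SameCoset R Gs) (Δ̃ R Gs x₀) c →
    Size (SameCoset R Gs) (IΔ R Gs x₀) d → ∃ λ Y → CosetPairs.Transversal Y × length Y + length Y ≡ c + d
  coset-transversal sΔ sC sD with Y , Y-tr ← CosetPairs.transversal sΔ = Y , Y-tr ,
    CosetPairs.transversal-count Y-tr sC sD
      (λ {y} → map₂ (subst (InK R Gs) (cong (y ·_) (sym (⁻¹-involutive y)))))
      (λ {y} Dy → (Dy ,_) ∘ subst (InK R Gs) (cong (y ·_) (⁻¹-involutive y)))

lemma3p8 : ∀ {n} (R : FinGroup n) (Gs : List (Fun n)) →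
    IsPermGroup Gs → ContainsR R Gs → IsTransitive R Gs → ProperlyContainsR R Gs →
    (x₀ : Fin n) → ΔInverseClosed R Gs x₀ →
    ∀ a b c d m →
    Size _≡_ (Δ̃ R Gs x₀) a → Size _≡_ (IΔ̃ R Gs x₀) b →
    Size (SameCoset R Gs) (Δ̃ R Gs x₀) c → Size (SameCoset R Gs) (IΔ R Gs x₀) d →
    Size _≡_ (InM R Gs x₀) m →
    m * 2 ^ 𝐜 c d ≤ 2 ^ (𝐜 a b + 1)
lemma3p8 R Gs pg cR _ _ x₀ Δ-inverse-closed a b c d _ sΔ sI sC sD (LM , refl , LM-balanced , LM-unique , _)
  = let P , P-tr , #P = element-transversal sΔ sI
        Y , Y-tr , #Y = coset-transversal sΔ sC sD
    in begin
    length LM * 2 ^ 𝐜 c d     ≡⟨ cong (λ k → length LM * 2 ^ k) (𝐜-double {c} {d} {length Y} #Y) ⟩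
    length LM * 2 ^ length Y  ≤⟨ CosetPairs.flip-bound Y-tr (ElementPairs.Transversal.covers P-tr) x₀∈Δ̃
                                   LM-unique LM-balanced ⟩
    2 ^ ℕ.suc (length P)      ≡⟨ cong (2 ^_) (+-comm 1 (length P)) ⟩
    2 ^ (length P + 1)        ≡⟨ cong (λ k → 2 ^ (k + 1)) (𝐜-double {a} {b} {length P} #P) ⟨
    2 ^ (𝐜 a b + 1)           ∎
  where
  open PairsInΔ̃ R Gs pg cR x₀ Δ-inverse-closed
  open ≤-Reasoning
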